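{- Let $n\ge 2$ and $s$ be integers, and let $S\subseteq\mathcal{S}_n$ be a set of permutations that is not transitive and has covering radius $\operatorname{crad}(S)\le n-s$. Then $f(n-1,s)\le |S|$.
   Context: $\mathcal{S}_n$ denotes the set of permutations of $[n]=\{1,\dots,n\}$, with the Hamming distance $d_H(\rho,\sigma)=|\{i\in[n]:\rho(i)\ne\sigma(i)\}|$. For $S\subseteq\mathcal{S}_n$, the covering radius $\operatorname{crad}(S)$ is the least $r$ such that for every $\rho\in\mathcal{S}_n$ there is $\sigma\in S$ with $d_H(\rho,\sigma)\le r$. $f(n,s)$ denotes the minimum size of a subset $S\subseteq\mathcal{S}_n$ with $\operatorname{crad}(S)\le n-s$, i.e. such that every $\rho\in\mathcal{S}_n$ is at Hamming distance at most $n-s$ from some $\sigma\in S$. A set $S\subseteq\mathcal{S}_n$ is transitive if for all $x,y\in[n]$ there exists $\sigma\in S$ with $\sigma(x)=y$. -}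

module Defs where

open import Data.Nat using (ℕ; zero; suc; _≤_)
open import Data.Fin using (Fin)
open import Data.Fin.Properties using (_≟_)
open import Data.List using (List; length)
open import Data.List.Membership.Propositional using (_∈_)
open import Data.List.Relation.Unary.AllPairs using (AllPairs)
open import Data.List using (filter; allFin)
open import Data.Integer using (ℤ; +_; _-_) renaming (_≤_ to _≤ℤ_)
open import Data.Product using (Σ; ∃; ∃-syntax; _×_)
open import Function.Bundles using (_↔_; Inverse)
open import Relation.Binary.PropositionalEquality using (_≡_)
open import Relation.Nullary using (¬_; Dec; yes; no; ¬?)

Perm : ℕ → Set
Perm n = Fin n ↔ Fin n

app : ∀ {n} → Perm n → Fin n → Fin n
app σ = Inverse.to σ

dH : ∀ {n} → Perm n → Perm n → ℕ
dH {n} ρ σ = length (filter (λ i → ¬? (app ρ i ≟ app σ i)) (allFin n))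

Distinct : ∀ {n} → Perm n → Perm n → Set
Distinct ρ σ = ¬ (∀ i → app ρ i ≡ app σ i)

record PermSet (n : ℕ) : Set where
  field
    elems    : List (Perm n)
    distinct : AllPairs Distinct elems

open PermSet public

card : ∀ {n} → PermSet n → ℕ
card S = length (elems S)

CradLe : ∀ {n} → PermSet n → ℤ → Set
CradLe {n} S r = (ρ : Perm n) → ∃[ σ ] (σ ∈ elems S × (+ dH ρ σ) ≤ℤ r)

Transitive : ∀ {n} → PermSet n → Set
Transitive {n} S = (x y : Fin n) → ∃[ σ ] (σ ∈ elems S × app σ x ≡ y)

-- f(n,s) ≤ k : the minimum size of a set with crad ≤ n - s is at most k,
-- i.e. some such set has size at most k (f = ∞ if no such set exists).
fLe : ℕ → ℤ → ℕ → Set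
fLe n s k = ∃[ T ] (CradLe {n} T (+ n - s) × card T ≤ k)

-- If S ⊆ Sₙ is not transitive, some pair x ↦ y is realised by no σ ∈ S.
-- Every σ ∈ S is first normalised to σ₁ = σ ∘ (x σ⁻¹(y)), which sends
-- x ↦ y and agrees with σ away from x and σ⁻¹(y), and then contracted to the
-- permutation Φ(σ) ∈ Sₙ₋₁ obtained by deleting x from the domain and y from
-- the codomain of σ₁.  For ρ' ∈ Sₙ₋₁ let ρ ∈ Sₙ be ρ' with x ↦ y inserted.
-- Every agreement of ρ and σ off x descends to an agreement of ρ' and Φ(σ),
-- and ρ, σ disagree at x, hence  d(ρ', Φ(σ)) + 1 ≤ d(ρ, σ).  So if S covers Sₙ with
-- radius n - s, the image Φ(S) covers Sₙ₋₁ with radius n - 1 - s, and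
-- removing repetitions gives a set of size at most |S|: f(n-1, s) ≤ |S|.
module Submission where

open import Defs
open import Data.Nat using (ℕ; _≤_)
open import Data.Integer using (ℤ; +_; _-_)
open import Relation.Nullary using (¬_)

open import Data.Nat using (zero; suc; _+_; z≤n; s≤s)
import Data.Nat.Properties
open import Data.Nat.Properties using (≤-refl; ≤-trans; ≤-reflexive; +-mono-≤; +-assoc; +-comm)
import Data.Integer as ℤ
import Data.Integer.Properties as ℤ
open import Data.Fin using (Fin; punchIn) renaming (zero to fzero; suc to fsuc)
open import Data.Fin.Properties using (_≟_; all?; ¬∀⟶∃¬; punchInᵢ≢i; punchIn-injective; punchIn-punchOut)
open import Data.Fin.Permutation using (_≈_; _∘ₚ_; _⟨$⟩ˡ_; transpose; remove; insert; insert-punchIn; inverseʳ)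
import Data.Fin.Permutation.Components as Components
open import Data.List using (List; []; _∷_; length; filter; tabulate; map; deduplicate)
open import Data.List.Properties using (length-map; length-deduplicate)
open import Data.List.Relation.Unary.Any using (any?)
import Data.List.Relation.Unary.Any as Any
open import Data.List.Relation.Unary.Any.Properties using (deduplicate⁺)
open import Data.List.Relation.Unary.All.Properties using (all-filter)
open import Data.List.Relation.Unary.AllPairs using (AllPairs; []; _∷_)
import Data.List.Relation.Unary.AllPairs.Properties as AllPairs
open import Data.List.Membership.Propositional using (_∈_; find; lose)
open import Data.List.Membership.Propositional.Properties using (∈-map⁺)
open import Data.Product using (∃-syntax; _×_; _,_; proj₁; proj₂)
open import Relation.Nullary using (Dec; yes; no; ¬?)
open import Relation.Nullary.Decidable using (map′)
open import Relation.Binary.PropositionalEquality using (_≡_; _≢_; refl; sym; trans; cong; subst)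
open import Data.Empty using (⊥-elim)
open import Function using (_∘_)

indicator : ∀ {p} {P : Set p} → Dec P → ℕ
indicator (yes _) = 1
indicator (no _)  = 0

count : ∀ {n p} {P : Fin n → Set p} → (∀ i → Dec (P i)) → ℕ
count {zero}  P? = 0
count {suc n} P? = indicator (P? fzero) + count (P? ∘ fsuc)

length-filter-tabulate : ∀ {n a p} {A : Set a} {P : A → Set p} (P? : ∀ x → Dec (P x))
  (f : Fin n → A) → length (filter P? (tabulate f)) ≡ count (P? ∘ f)
length-filter-tabulate {zero}  P? f = refl
length-filter-tabulate {suc n} P? f with P? (f fzero)
... | yes _ = cong suc (length-filter-tabulate P? (f ∘ fsuc))
... | no _  = length-filter-tabulate P? (f ∘ fsuc)

indicator-mono : ∀ {p q} {P : Set p} {Q : Set q} (P? : Dec P) (Q? : Dec Q) →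
  (P → Q) → indicator P? ≤ indicator Q?
indicator-mono (yes p) (yes _) P⇒Q = ≤-refl
indicator-mono (yes p) (no ¬q) P⇒Q = ⊥-elim (¬q (P⇒Q p))
indicator-mono (no _)  Q?      P⇒Q = z≤n

count-mono : ∀ {n p q} {P : Fin n → Set p} {Q : Fin n → Set q}
  (P? : ∀ i → Dec (P i)) (Q? : ∀ i → Dec (Q i)) → (∀ i → P i → Q i) → count P? ≤ count Q?
count-mono {zero}  P? Q? P⇒Q = z≤n
count-mono {suc n} P? Q? P⇒Q = +-mono-≤ (indicator-mono (P? fzero) (Q? fzero) (P⇒Q fzero))
  (count-mono (P? ∘ fsuc) (Q? ∘ fsuc) (P⇒Q ∘ fsuc))

-- Splitting off an arbitrary point x: Fin (suc m) is x together with the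
-- image of punchIn x.
count-punchIn : ∀ {m p} {P : Fin (suc m) → Set p} (P? : ∀ i → Dec (P i)) (x : Fin (suc m)) →
  count P? ≡ indicator (P? x) + count (P? ∘ punchIn x)
count-punchIn          P? fzero    = refl
count-punchIn {suc m}  P? (fsuc x) = begin
  a + count (P? ∘ fsuc)                   ≡⟨ cong (λ t → a + t) (count-punchIn (P? ∘ fsuc) x) ⟩
  a + (b + c)                             ≡⟨ sym (+-assoc a b c) ⟩
  (a + b) + c                             ≡⟨ cong (_+ c) (+-comm a b) ⟩
  (b + a) + c                             ≡⟨ +-assoc b a c ⟩
  b + (a + c)                             ∎
  where
  open Relation.Binary.PropositionalEquality.≡-Reasoning
  a b c : ℕ
  a = indicator (P? fzero)
  b = indicator (P? (fsuc x))
  c = count (P? ∘ fsuc ∘ punchIn x)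

disagree? : ∀ {n} (ρ σ : Perm n) (i : Fin n) → Dec (app ρ i ≢ app σ i)
disagree? ρ σ i = ¬? (app ρ i ≟ app σ i)

dH≡count : ∀ {n} (ρ σ : Perm n) → dH ρ σ ≡ count (disagree? ρ σ)
dH≡count ρ σ = length-filter-tabulate (disagree? ρ σ) (λ i → i)

-- Replacing σ by a pointwise equal τ does not increase the distance from ρ
-- (used to pass from a contraction to its representative after deduplication).
dH-resp-≈ : ∀ {n} (ρ σ τ : Perm n) → σ ≈ τ → dH ρ τ ≤ dH ρ σ
dH-resp-≈ ρ σ τ σ≈τ = begin
  dH ρ τ                   ≡⟨ dH≡count ρ τ ⟩
  count (disagree? ρ τ)    ≤⟨ count-mono (disagree? ρ τ) (disagree? ρ σ) differs-from-σ ⟩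
  count (disagree? ρ σ)    ≡⟨ dH≡count ρ σ ⟨
  dH ρ σ                   ∎
  where
  open Data.Nat.Properties.≤-Reasoning
  differs-from-σ : ∀ i → app ρ i ≢ app τ i → app ρ i ≢ app σ i
  differs-from-σ i ρi≢τi ρi≡σi = ρi≢τi (trans ρi≡σi (σ≈τ i))

dH-split : ∀ {m} (ρ σ : Perm (suc m)) (x : Fin (suc m)) → app ρ x ≢ app σ x →
  dH ρ σ ≡ suc (count (disagree? ρ σ ∘ punchIn x))
dH-split ρ σ x ρx≢σx with disagree? ρ σ x | count-punchIn (disagree? ρ σ) x
... | yes _       | split = trans (dH≡count ρ σ) split
... | no ρx≡σx    | _     = ⊥-elim (ρx≡σx ρx≢σx)

transpose-sends : ∀ {n} (i j : Fin n) → Components.transpose i j i ≡ j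
transpose-sends i j with i ≟ i
... | yes _  = refl
... | no i≢i = ⊥-elim (i≢i refl)

transpose-fixes : ∀ {n} (i j k : Fin n) → k ≢ i → k ≢ j → Components.transpose i j k ≡ k
transpose-fixes i j k k≢i k≢j with k ≟ i
... | yes k≡i = ⊥-elim (k≢i k≡i)
... | no _ with k ≟ j
...   | yes k≡j = ⊥-elim (k≢j k≡j)
...   | no _    = refl

insert-sends : ∀ {m} (i j : Fin (suc m)) (π : Perm m) → app (insert i j π) i ≡ j
insert-sends i j π with i ≟ i
... | yes _  = refl
... | no i≢i = ⊥-elim (i≢i refl)

module Contraction {m : ℕ} (x y : Fin (suc m)) where

  normalise : Perm (suc m) → Perm (suc m)
  normalise σ = transpose x (σ ⟨$⟩ˡ y) ∘ₚ σ

  normalise-x : ∀ σ → app (normalise σ) x ≡ y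
  normalise-x σ = trans (cong (app σ) (transpose-sends x (σ ⟨$⟩ˡ y))) (inverseʳ σ)

  normalise-agrees : ∀ σ k → k ≢ x → k ≢ σ ⟨$⟩ˡ y → app (normalise σ) k ≡ app σ k
  normalise-agrees σ k k≢x k≢σ⁻¹y = cong (app σ) (transpose-fixes x (σ ⟨$⟩ˡ y) k k≢x k≢σ⁻¹y)

  contract : Perm (suc m) → Perm m
  contract σ = remove x (normalise σ)

  contract-punchIn : ∀ σ i → punchIn y (app (contract σ) i) ≡ app (normalise σ) (punchIn x i)
  contract-punchIn σ i =
    subst (λ z → punchIn z (app (contract σ) i) ≡ app (normalise σ) (punchIn x i))
      (normalise-x σ) (punchIn-punchOut _)

  agreement-descends : ∀ σ (ρ' : Perm m) i →
    app (insert x y ρ') (punchIn x i) ≡ app σ (punchIn x i) → app ρ' i ≡ app (contract σ) i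
  agreement-descends σ ρ' i agree = punchIn-injective y _ _ (begin
    punchIn y (app ρ' i)                ≡⟨ σ-value ⟨
    app σ (punchIn x i)                 ≡⟨ normalise-agrees σ (punchIn x i) (punchInᵢ≢i x i) avoids-σ⁻¹y ⟨
    app (normalise σ) (punchIn x i)     ≡⟨ contract-punchIn σ i ⟨
    punchIn y (app (contract σ) i)      ∎)
    where
    open Relation.Binary.PropositionalEquality.≡-Reasoning
    σ-value : app σ (punchIn x i) ≡ punchIn y (app ρ' i)
    σ-value = trans (sym agree) (insert-punchIn x y ρ' i)
    -- σ maps punchIn x i to punchIn y (ρ' i), which is not y.
    avoids-σ⁻¹y : punchIn x i ≢ σ ⟨$⟩ˡ y
    avoids-σ⁻¹y eq = punchInᵢ≢i y (app ρ' i)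
      (trans (sym σ-value) (trans (cong (app σ) eq) (inverseʳ σ)))

  distance-drops : ∀ σ (ρ' : Perm m) → app σ x ≢ y → suc (dH ρ' (contract σ)) ≤ dH (insert x y ρ') σ
  distance-drops σ ρ' σx≢y = begin
    suc (dH ρ' (contract σ))                     ≡⟨ cong suc (dH≡count ρ' (contract σ)) ⟩
    suc (count (disagree? ρ' (contract σ)))      ≤⟨ s≤s (count-mono _ _ disagreement-lifts) ⟩
    suc (count (disagree? ρ σ ∘ punchIn x))      ≡⟨ dH-split ρ σ x ρx≢σx ⟨
    dH ρ σ                                       ∎
    where
    open Data.Nat.Properties.≤-Reasoning
    ρ : Perm (suc m)
    ρ = insert x y ρ'
    disagreement-lifts : ∀ i → app ρ' i ≢ app (contract σ) i → app ρ (punchIn x i) ≢ app σ (punchIn x i)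
    disagreement-lifts i ρ'≢Φσ agree = ρ'≢Φσ (agreement-descends σ ρ' i agree)
    ρx≢σx : app ρ x ≢ app σ x
    ρx≢σx ρx≡σx = σx≢y (trans (sym ρx≡σx) (insert-sends x y ρ'))

_≈?_ : ∀ {n} (ρ σ : Perm n) → Dec (ρ ≈ σ)
ρ ≈? σ = all? (λ i → app ρ i ≟ app σ i)

distinctEntries : ∀ {n} → List (Perm n) → PermSet n
distinctEntries xs = record
  { elems    = deduplicate _≈?_ xs
  ; distinct = deduplicate-distinct xs
  }
  where
  deduplicate-distinct : ∀ xs → AllPairs Distinct (deduplicate _≈?_ xs)
  deduplicate-distinct []       = []
  deduplicate-distinct (ρ ∷ xs) =
    all-filter (¬? ∘ (ρ ≈?_)) (deduplicate _≈?_ xs) ∷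
    AllPairs.filter⁺ (¬? ∘ (ρ ≈?_)) (deduplicate-distinct xs)

card-distinctEntries : ∀ {n} (xs : List (Perm n)) → card (distinctEntries xs) ≤ length xs
card-distinctEntries = length-deduplicate _≈?_

distinctEntries-represent : ∀ {n} {xs : List (Perm n)} {σ} → σ ∈ xs →
  ∃[ τ ] (τ ∈ elems (distinctEntries xs) × σ ≈ τ)
distinctEntries-represent σ∈xs =
  find (deduplicate⁺ _≈?_ (λ τ≈υ σ≈τ i → trans (σ≈τ i) (sym (τ≈υ i))) (Any.map (λ { refl i → refl }) σ∈xs))

drop-unit : ∀ (d m : ℕ) (s : ℤ) → + suc d ℤ.≤ + suc m - s → + d ℤ.≤ + m - s
drop-unit d m s bound = subst (+ d ℤ.≤_) pred-shift (ℤ.i<j⇒i≤pred[j] (ℤ.suc[i]≤j⇒i<j bound))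
  where
  pred-shift : ℤ.pred (+ suc m - s) ≡ + m - s
  pred-shift = sym (ℤ.pred-+ (+ suc m) (ℤ.- s))

Realises : ∀ {n} → PermSet n → Fin n → Fin n → Set
Realises S x y = ∃[ σ ] (σ ∈ elems S × app σ x ≡ y)

realises? : ∀ {n} (S : PermSet n) (x y : Fin n) → Dec (Realises S x y)
realises? S x y = map′ find (λ (σ , σ∈S , σx≡y) → lose σ∈S σx≡y) (any? (λ σ → app σ x ≟ y) (elems S))

missed-pair : ∀ {n} (S : PermSet n) → ¬ Transitive S →
  ∃[ x ] ∃[ y ] (∀ σ → σ ∈ elems S → app σ x ≢ y)
missed-pair {n} S intransitive = x , y , λ σ σ∈S σx≡y → y-missed (σ , σ∈S , σx≡y)
  where
  x-missing : ∃[ x ] ¬ (∀ y → Realises S x y)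
  x-missing = ¬∀⟶∃¬ n (λ x → ∀ y → Realises S x y) (λ x → all? (realises? S x)) intransitive
  x : Fin n
  x = proj₁ x-missing
  y-missing : ∃[ y ] ¬ Realises S x y
  y-missing = ¬∀⟶∃¬ n (Realises S x) (realises? S x) (proj₂ x-missing)
  y : Fin n
  y = proj₁ y-missing
  y-missed : ¬ Realises S x y
  y-missed = proj₂ y-missing

contraction-covers : ∀ (m : ℕ) (s : ℤ) (S : PermSet (suc m)) (x y : Fin (suc m)) →
  (∀ σ → σ ∈ elems S → app σ x ≢ y) → CradLe S (+ suc m - s) → fLe m s (card S)
contraction-covers m s S x y misses covers = T , T-covers , T-small
  where
  open Contraction x y
  T : PermSet m
  T = distinctEntries (map contract (elems S))
  T-small : card T ≤ card S
  T-small = ≤-trans (card-distinctEntries (map contract (elems S))) (≤-reflexive (length-map contract (elems S)))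
  descend : (ρ' : Perm m) → ∃[ σ ] (σ ∈ elems S × + dH (insert x y ρ') σ ℤ.≤ + suc m - s) →
    ∃[ τ ] (τ ∈ elems T × + dH ρ' τ ℤ.≤ + m - s)
  descend ρ' (σ , σ∈S , close) = τ , τ∈T , drop-unit (dH ρ' τ) m s (ℤ.≤-trans (ℤ.+≤+ d-bound) close)
    where
    representative : ∃[ τ ] (τ ∈ elems T × contract σ ≈ τ)
    representative = distinctEntries-represent (∈-map⁺ contract σ∈S)
    τ : Perm m
    τ = proj₁ representative
    τ∈T : τ ∈ elems T
    τ∈T = proj₁ (proj₂ representative)
    d-bound : suc (dH ρ' τ) ≤ dH (insert x y ρ') σ
    d-bound = ≤-trans (s≤s (dH-resp-≈ ρ' (contract σ) τ (proj₂ (proj₂ representative))))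
                      (distance-drops σ ρ' (misses σ σ∈S))
  T-covers : CradLe T (+ m - s)
  T-covers ρ' = descend ρ' (covers (insert x y ρ'))

-- The theorem: contract a non-transitive covering set along a missed pair.
mainTheorem1 : (n : ℕ) → 2 ≤ n → (s : ℤ) → (S : PermSet n) →
    ¬ Transitive S → CradLe S (+ n - s) →
    fLe (n Data.Nat.∸ 1) s (card S)
mainTheorem1 (suc m) _ s S intransitive covers =
  let x , y , misses = missed-pair S intransitive
  in  contraction-covers m s S x y misses covers
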